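{- $\mathrm{PL}\subsetneq\mathrm{ST}$.
   Context: A random-access Turing machine (RATM) is a Turing machine with $k\ge 2$ ordinary tapes (a read-only input tape, an output tape and work tapes), each equipped with its own write-only binary index tape; in each step it reads the symbols under the ordinary heads, writes on the writable ordinary tapes and on the index tapes, moves all heads, and changes state; when it enters a special random-access state $q_a$, the heads of all ordinary tapes jump (in that step) to the cells whose addresses are written in binary on the respective index tapes. Running time is the number of steps; $n$ is the input length. $\mathrm{PL}$ is the class of decision problems solvable by a RATM in polylogarithmic time, i.e. in time $O(\log^i n)$ for some $i\ge1$. $\mathrm{ST}$ is the class of decision problems solvable by a RATM in time $o(n)$. -}

module Defs where

open import Data.Nat using (ℕ; zero; suc; _+_; _*_; _^_; _≤_)
open import Data.Nat.Logarithm using (⌊log₂_⌋)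
open import Data.Bool using (Bool; true; false; if_then_else_)
open import Data.Maybe using (Maybe; just; nothing)
open import Data.List using (List; []; _∷_; length)
open import Data.Fin using (Fin; zero; suc; _≟_)
open import Data.Product using (Σ; ∃; _×_; _,_)
open import Relation.Nullary using (¬_; does)
open import Relation.Binary.PropositionalEquality using (_≡_; _≢_)

-- Tapes: tape 0 is the read-only input tape (over {0,1}, blank beyond the
-- input); the "writable" tapes are indexed by Fin (suc w): writable tape 0
-- is the output tape, the others are the w work tapes.  So the machine has
-- k = 2 + w ≥ 2 ordinary tapes.  Each ordinary tape has its own write-only
-- index tape; index tapes are indexed by Fin (2 + w), where index tape
-- zero belongs to the input tape and index tape (suc i) to writable tape i.
-- Index tape cells hold a blank (nothing) or a bit (just b).

data Move : Set where
  left stay right : Move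

move : Move → ℕ → ℕ
move left  zero    = zero
move left  (suc h) = h
move stay  h       = h
move right h       = suc h

-- tape symbols of the writable tapes: Fin (suc s), zero is the blank
record Action (nQ s w : ℕ) : Set where
  field
    next     : Fin nQ
    inMove   : Move
    write    : Fin (suc w) → Fin (suc s)
    wMove    : Fin (suc w) → Move
    idxWrite : Fin (2 + w) → Maybe Bool
    idxMove  : Fin (2 + w) → Move

record RATM : Set where
  field
    nQ   : ℕ
    s    : ℕ
    w    : ℕ
    q₀   : Fin nQ
    qₐ   : Fin nQ           -- random-access state
    qacc : Fin nQ
    qrej : Fin nQ
    acc≢rej : qacc ≢ qrej
    -- transition function: current state, symbol under the input head
    -- (nothing = blank), symbols under the writable heads
    δ    : Fin nQ → Maybe Bool → (Fin (suc w) → Fin (suc s)) → Action nQ s w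

record Config (M : RATM) : Set where
  open RATM M
  field
    state    : Fin nQ
    inHead   : ℕ
    wTape    : Fin (suc w) → ℕ → Fin (suc s)
    wHead    : Fin (suc w) → ℕ
    idxTape  : Fin (2 + w) → List (Maybe Bool)   -- cells 0 .. (length-1); blank beyond
    idxHead  : Fin (2 + w) → ℕ

nth : {A : Set} → List A → ℕ → Maybe A
nth []       _       = nothing
nth (x ∷ xs) zero    = just x
nth (x ∷ xs) (suc i) = nth xs i

setAt : List (Maybe Bool) → ℕ → Maybe Bool → List (Maybe Bool)
setAt []       zero    v = v ∷ []
setAt []       (suc h) v = nothing ∷ setAt [] h v
setAt (x ∷ xs) zero    v = v ∷ xs
setAt (x ∷ xs) (suc h) v = x ∷ setAt xs h v

bit : Bool → ℕ
bit false = 0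
bit true  = 1

-- the address written in binary on an index tape: the bits in cells
-- 0,1,2,... up to the first blank, most significant bit first
addrFrom : ℕ → List (Maybe Bool) → ℕ
addrFrom acc []             = acc
addrFrom acc (nothing ∷ _)  = acc
addrFrom acc (just b ∷ xs)  = addrFrom (2 * acc + bit b) xs

address : List (Maybe Bool) → ℕ
address = addrFrom 0

update : {A : Set} → (ℕ → A) → ℕ → A → (ℕ → A)
update f h a i = if does (Data.Nat._≟_ i h) then a else f i

result : {M : RATM} → Config M → Maybe Bool
result {M} c =
  if does (Config.state c ≟ RATM.qacc M) then just true
  else if does (Config.state c ≟ RATM.qrej M) then just false
  else nothing

initial : (M : RATM) → Config M
initial M = record
  { state = RATM.q₀ M ; inHead = 0 ; wTape = λ _ _ → zero ; wHead = λ _ → 0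
  ; idxTape = λ _ → [] ; idxHead = λ _ → 0 }

-- one ordinary step (for a non-halted configuration); when the new state
-- is the random-access state, the ordinary heads jump (in the same step)
-- to the addresses written on the respective (updated) index tapes
step′ : (M : RATM) → List Bool → Config M → Config M
step′ M inp c =
  if does (Action.next a ≟ RATM.qₐ M)
  then record c′ { inHead = address (idx zero)
                 ; wHead = λ i → address (idx (suc i)) }
  else c′
  where
    open Config c
    a : Action (RATM.nQ M) (RATM.s M) (RATM.w M)
    a = RATM.δ M state (nth inp inHead) (λ i → wTape i (wHead i))
    idx : Fin (2 + RATM.w M) → List (Maybe Bool)
    idx j = setAt (idxTape j) (idxHead j) (Action.idxWrite a j)
    c′ : Config M
    c′ = record
      { state   = Action.next a
      ; inHead  = move (Action.inMove a) inHead
      ; wTape   = λ i → update (wTape i) (wHead i) (Action.write a i)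
      ; wHead   = λ i → move (Action.wMove a i) (wHead i)
      ; idxTape = idx
      ; idxHead = λ j → move (Action.idxMove a j) (idxHead j) }

step : (M : RATM) → List Bool → Config M → Config M
step M inp c with result c
... | nothing = step′ M inp c
... | just _  = c

run : (M : RATM) → List Bool → ℕ → Config M
run M inp zero    = initial M
run M inp (suc t) = step M inp (run M inp t)

HaltsWithin : RATM → List Bool → ℕ → Bool → Set
HaltsWithin M x t b = result (run M x t) ≡ just b

Problem : Set
Problem = List Bool → Bool

Decides : RATM → Problem → Set
Decides M P = ∀ x → ∃ λ t → HaltsWithin M x t (P x)

PL : Problem → Set
PL P = Σ RATM λ M → Decides M P ×
  (∃ λ i → 1 ≤ i × ∃ λ c → ∃ λ n₀ → ∀ x → n₀ ≤ length x →
     HaltsWithin M x (c * (⌊log₂ length x ⌋ ^ i)) (P x))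

-- ST: decidable by a RATM in time o(n), i.e. for every c there is n₀
-- such that on inputs of length n ≥ n₀ the running time t satisfies c·t ≤ n
ST : Problem → Set
ST P = Σ RATM λ M → Decides M P ×
  (∀ c → ∃ λ n₀ → ∀ x → n₀ ≤ length x →
     ∃ λ t → c * t ≤ length x × HaltsWithin M x t (P x))

module Submission where

-- A machine running in time c·⌊log₂ n⌋^i also runs in time o(n),
-- since every polynomial in k is eventually below 2^k (poly≤exp) and so every
-- polylogarithm is eventually below n (polylog≤id).
--
-- The witness is Ones: accept x iff its cells 0, …, 2^H contain no 0,
-- where H = 1 + ⌊⌈log₂ n⌉/2⌋, so that 2^H is about 2√n.
--   (a) Ones ∈ ST.  A 7-state machine probes the cells 2^0, 2^1, … by random access
--       until it hits a blank at 2^⌈log₂ n⌉, meanwhile writing the address 2^H on the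
--       index tape of its output tape, which it uses as a counter; it then scans the
--       input, counting down from 2^H.  Its invariants are recorded phase by phase
--       (Probing, Rewinding, Scanning); it halts within 5·2^H = O(√n) = o(n) steps.
--   (b) Ones ∉ PL.  A run of T steps leaves some input cell p ≤ T unread
--       (unread-cell, by pigeonhole).  On the all-ones input of length 2^(2u) a
--       polylogarithmic T is at most 2^u < 2^H, so setting cell p to 0 flips the
--       answer without changing the run.

open import Defs
open import Data.Bool using (Bool; true; false; if_then_else_)
import Data.Bool as Bool
open import Data.Empty using (⊥-elim)
open import Data.Fin using (Fin; zero; suc; toℕ; fromℕ<; _≟_)
open import Data.Fin.Properties using (any?; ¬∀⟶∃¬; injective⇒≤; toℕ-injective; toℕ-fromℕ<; toℕ≤pred[n])
open import Data.List using (List; length; []; _∷_; _++_; replicate)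
open import Data.List.Properties using (length-replicate; ++-identityʳ)
open import Data.Maybe using (Maybe; nothing; just)
open import Data.Nat hiding (_≟_)
import Data.Nat as ℕ
open import Data.Nat.Induction using (<-rec; <-wellFounded)
open import Data.Nat.Logarithm
open import Data.Nat.Logarithm.Core using (⌈log2⌉-acc-irrelevant)
open import Data.Nat.Properties hiding (_≟_)
open import Data.Nat.Solver using (module +-*-Solver)
open +-*-Solver using (solve; _:+_; _:*_; _:=_; con)
open import Data.Product using (∃; _×_; _,_; proj₁; proj₂)
open import Data.Sum using (_⊎_; inj₁; inj₂)
open import Data.Unit using (tt)
open import Function using (_∘_; _∘′_)
open import Induction.WellFounded using (acc)
open import Relation.Binary.PropositionalEquality
open import Relation.Nullary using (¬_; does; yes; no)

-- The library defines ⌈log₂⌉ by well-founded recursion; this is its defining equation.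
⌈log₂⌉-unfold : ∀ m → ⌈log₂ suc (suc m) ⌉ ≡ suc ⌈log₂ suc ⌈ m /2⌉ ⌉
⌈log₂⌉-unfold m = ⌈log2⌉-acc-irrelevant (suc (suc m)) {<-wellFounded _} {acc λ _ → <-wellFounded _}

m≤⌈m/2⌉+⌈m/2⌉ : ∀ m → m ≤ ⌈ m /2⌉ + ⌈ m /2⌉
m≤⌈m/2⌉+⌈m/2⌉ m = begin
  m                     ≡⟨ sym (⌊n/2⌋+⌈n/2⌉≡n m) ⟩
  ⌊ m /2⌋ + ⌈ m /2⌉     ≤⟨ +-monoˡ-≤ ⌈ m /2⌉ (⌊n/2⌋≤⌈n/2⌉ m) ⟩
  ⌈ m /2⌉ + ⌈ m /2⌉     ∎
  where open ≤-Reasoning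

⌈m/2⌉+⌈m/2⌉≤1+m : ∀ m → ⌈ m /2⌉ + ⌈ m /2⌉ ≤ suc m
⌈m/2⌉+⌈m/2⌉≤1+m m = begin
  ⌈ m /2⌉ + ⌈ m /2⌉     ≤⟨ +-monoʳ-≤ ⌈ m /2⌉ (⌊n/2⌋≤⌈n/2⌉ (suc m)) ⟩
  ⌊ suc m /2⌋ + ⌈ suc m /2⌉ ≡⟨ ⌊n/2⌋+⌈n/2⌉≡n (suc m) ⟩
  suc m                 ∎
  where open ≤-Reasoning

2^[1+k]≡2^k+2^k : ∀ k → 2 ^ suc k ≡ 2 ^ k + 2 ^ k
2^[1+k]≡2^k+2^k k = cong (2 ^ k +_) (+-identityʳ (2 ^ k))

n≤2^⌈log₂n⌉ : ∀ n → n ≤ 2 ^ ⌈log₂ n ⌉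
n≤2^⌈log₂n⌉ = <-rec _ bound
  where
  bound : ∀ n → (∀ {m} → m < n → m ≤ 2 ^ ⌈log₂ m ⌉) → n ≤ 2 ^ ⌈log₂ n ⌉
  bound 0 _ = z≤n
  bound 1 _ = s≤s z≤n
  bound (suc (suc m)) ih = subst (λ l → 2 + m ≤ 2 ^ l) (sym (⌈log₂⌉-unfold m)) (begin
    2 + m                        ≤⟨ +-monoʳ-≤ 2 (m≤⌈m/2⌉+⌈m/2⌉ m) ⟩
    2 + (⌈ m /2⌉ + ⌈ m /2⌉)      ≡⟨ cong suc (sym (+-suc ⌈ m /2⌉ ⌈ m /2⌉)) ⟩
    suc ⌈ m /2⌉ + suc ⌈ m /2⌉    ≤⟨ +-mono-≤ half≤ half≤ ⟩
    2 ^ L + 2 ^ L                ≡⟨ sym (2^[1+k]≡2^k+2^k L) ⟩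
    2 ^ suc L                    ∎)
    where
    open ≤-Reasoning
    L = ⌈log₂ suc ⌈ m /2⌉ ⌉
    half≤ : suc ⌈ m /2⌉ ≤ 2 ^ L
    half≤ = ih (s≤s (s≤s (⌈n/2⌉≤n m)))

2^k<n : ∀ n k → ⌈log₂ n ⌉ ≡ suc k → 2 ^ k < n
2^k<n = <-rec _ bound
  where
  bound : ∀ n → (∀ {m} → m < n → ∀ k → ⌈log₂ m ⌉ ≡ suc k → 2 ^ k < m) →
          ∀ k → ⌈log₂ n ⌉ ≡ suc k → 2 ^ k < n
  bound (suc (suc m)) ih k eq with ⌈log₂ suc ⌈ m /2⌉ ⌉ in e | trans (sym (⌈log₂⌉-unfold m)) eq
  ... | zero  | refl = s≤s (s≤s z≤n)
  ... | suc L | refl = begin-strict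
    2 ^ suc L                   ≡⟨ 2^[1+k]≡2^k+2^k L ⟩
    2 ^ L + 2 ^ L               ≤⟨ +-mono-≤ half> half> ⟩
    ⌈ m /2⌉ + ⌈ m /2⌉           ≤⟨ ⌈m/2⌉+⌈m/2⌉≤1+m m ⟩
    suc m                       <⟨ n<1+n (suc m) ⟩
    suc (suc m)                 ∎
    where
    open ≤-Reasoning
    half> : 2 ^ L ≤ ⌈ m /2⌉
    half> = s≤s⁻¹ (ih (s≤s (s≤s (⌈n/2⌉≤n m))) L e)

⌈log₂⌉-≥ : ∀ {k n} → 2 ^ k ≤ n → k ≤ ⌈log₂ n ⌉
⌈log₂⌉-≥ {k} le = subst (_≤ _) (⌈log₂2^n⌉≡n k) (⌈log₂⌉-mono-≤ le)

⌊log₂⌋≤⌈log₂⌉ : ∀ n → ⌊log₂ n ⌋ ≤ ⌈log₂ n ⌉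
⌊log₂⌋≤⌈log₂⌉ n = subst (⌊log₂ n ⌋ ≤_) (⌊log₂[2^n]⌋≡n ⌈log₂ n ⌉) (⌊log₂⌋-mono-≤ (n≤2^⌈log₂n⌉ n))

1+k≤2^k : ∀ k → suc k ≤ 2 ^ k
1+k≤2^k zero    = s≤s z≤n
1+k≤2^k (suc k) = subst (2 + k ≤_) (sym (2^[1+k]≡2^k+2^k k)) (+-mono-≤ (m^n>0 2 k) (1+k≤2^k k))

k≤2^k : ∀ k → k ≤ 2 ^ k
k≤2^k k = <⇒≤ (1+k≤2^k k)

linear≤exp : ∀ a → ∃ λ ℓ₀ → ∀ ℓ → ℓ₀ ≤ ℓ → suc ℓ * a ≤ 2 ^ ℓ
linear≤exp a = ℓ₀ , λ ℓ ℓ₀≤ℓ → subst (λ ℓ → suc ℓ * a ≤ 2 ^ ℓ) (m∸n+n≡m ℓ₀≤ℓ) (beyond (ℓ ∸ ℓ₀))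
  where
  ℓ₀ = a + suc a
  start : suc ℓ₀ * a ≤ 2 ^ ℓ₀
  start = begin
    (suc a + suc a) * a      ≤⟨ *-mono-≤ (+-mono-≤ (1+k≤2^k a) (1+k≤2^k a)) (k≤2^k a) ⟩
    (2 ^ a + 2 ^ a) * 2 ^ a  ≡⟨ cong (_* 2 ^ a) (sym (2^[1+k]≡2^k+2^k a)) ⟩
    2 ^ suc a * 2 ^ a        ≡⟨ sym (^-distribˡ-+-* 2 (suc a) a) ⟩
    2 ^ (suc a + a)          ≡⟨ cong (2 ^_) (+-comm (suc a) a) ⟩
    2 ^ ℓ₀                   ∎
    where open ≤-Reasoning
  -- each further step adds a ≤ 2^ℓ on the left and doubles the right
  beyond : ∀ r → suc (r + ℓ₀) * a ≤ 2 ^ (r + ℓ₀)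
  beyond zero    = start
  beyond (suc r) = begin
    a + suc (r + ℓ₀) * a     ≤⟨ +-mono-≤ a≤2^ℓ (beyond r) ⟩
    2 ^ (r + ℓ₀) + 2 ^ (r + ℓ₀) ≡⟨ sym (2^[1+k]≡2^k+2^k (r + ℓ₀)) ⟩
    2 ^ suc (r + ℓ₀)         ∎
    where
    open ≤-Reasoning
    a≤2^ℓ : a ≤ 2 ^ (r + ℓ₀)
    a≤2^ℓ = ≤-trans (k≤2^k a) (^-monoʳ-≤ 2 (≤-trans (m≤m+n a (suc a)) (m≤n+m ℓ₀ r)))

-- Every polynomial c·(k+1)^i is eventually below 2^k: writing k+1 ≤ 2^L with
-- L = ⌈log₂ (k+1)⌉, it is at most 2^(c + L·i), and c + L·i ≤ k once k is large.
poly≤exp : ∀ c i → ∃ λ k₀ → ∀ k → k₀ ≤ k → c * suc k ^ i ≤ 2 ^ k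
poly≤exp c i with linear≤exp (c + i)
... | ℓ₀ , linear = 2 ^ suc ℓ₀ , bound
  where
  bound : ∀ k → 2 ^ suc ℓ₀ ≤ k → c * suc k ^ i ≤ 2 ^ k
  bound k le with ⌈log₂ suc k ⌉ in e | ⌈log₂⌉-≥ {suc ℓ₀} {suc k} (m≤n⇒m≤1+n le)
  ... | suc L | s≤s ℓ₀≤L = begin
    c * suc k ^ i                ≤⟨ *-mono-≤ (k≤2^k c) (^-monoˡ-≤ i k+1≤2^[1+L]) ⟩
    2 ^ c * (2 ^ suc L) ^ i      ≡⟨ cong (2 ^ c *_) (^-*-assoc 2 (suc L) i) ⟩
    2 ^ c * 2 ^ (suc L * i)      ≡⟨ sym (^-distribˡ-+-* 2 c (suc L * i)) ⟩
    2 ^ (c + suc L * i)          ≤⟨ ^-monoʳ-≤ 2 exponent≤k ⟩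
    2 ^ k                        ∎
    where
    open ≤-Reasoning
    k+1≤2^[1+L] : suc k ≤ 2 ^ suc L
    k+1≤2^[1+L] = subst (λ l → suc k ≤ 2 ^ l) e (n≤2^⌈log₂n⌉ (suc k))
    exponent≤k : c + suc L * i ≤ k
    exponent≤k = begin
      c + suc L * i              ≤⟨ +-monoˡ-≤ (suc L * i) (m≤n*m c (suc L)) ⟩
      suc L * c + suc L * i      ≡⟨ sym (*-distribˡ-+ (suc L) c i) ⟩
      suc L * (c + i)            ≤⟨ linear L ℓ₀≤L ⟩
      2 ^ L                      ≤⟨ s≤s⁻¹ (2^k<n (suc k) L e) ⟩
      k                          ∎

polylog≤id : ∀ c i → ∃ λ n₀ → ∀ n → n₀ ≤ n → c * ⌊log₂ n ⌋ ^ i ≤ n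
polylog≤id c i with poly≤exp c i
... | k₀ , poly = 2 ^ suc k₀ , bound
  where
  bound : ∀ n → 2 ^ suc k₀ ≤ n → c * ⌊log₂ n ⌋ ^ i ≤ n
  bound n le with ⌈log₂ n ⌉ in e | ⌈log₂⌉-≥ {suc k₀} {n} le
  ... | suc k | s≤s k₀≤k = begin
    c * ⌊log₂ n ⌋ ^ i            ≤⟨ *-monoʳ-≤ c (^-monoˡ-≤ i (subst (⌊log₂ n ⌋ ≤_) e (⌊log₂⌋≤⌈log₂⌉ n))) ⟩
    c * suc k ^ i                ≤⟨ poly k k₀≤k ⟩
    2 ^ k                        ≤⟨ <⇒≤ (2^k<n n k e) ⟩
    n                            ∎
    where open ≤-Reasoning

*-^ : ∀ a b i → (a * b) ^ i ≡ a ^ i * b ^ i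
*-^ a b zero    = refl
*-^ a b (suc i) rewrite *-^ a b i =
  solve 4 (λ a b A B → (a :* b) :* (A :* B) := (a :* A) :* (b :* B)) refl a b (a ^ i) (b ^ i)

polylog≤√ : ∀ c i → ∃ λ u₀ → ∀ u → u₀ ≤ u → c * (u + u) ^ i ≤ 2 ^ u
polylog≤√ c i with poly≤exp (c * 2 ^ i) i
... | u₀ , poly = u₀ , λ u u₀≤u → begin
    c * (u + u) ^ i          ≤⟨ *-monoʳ-≤ c (^-monoˡ-≤ i (+-mono-≤ (n≤1+n u) (≤-trans (n≤1+n u) (m≤m+n (suc u) 0)))) ⟩
    c * (2 * suc u) ^ i      ≡⟨ cong (c *_) (*-^ 2 (suc u) i) ⟩
    c * (2 ^ i * suc u ^ i)  ≡⟨ sym (*-assoc c (2 ^ i) _) ⟩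
    c * 2 ^ i * suc u ^ i    ≤⟨ poly u u₀≤u ⟩
    2 ^ u                    ∎
  where open ≤-Reasoning

-- PL ⊆ ST: the same machine, since c′·(c·log^i n) ≤ n for large n.
PL⊆ST : (P : Problem) → PL P → ST P
PL⊆ST P (M , decides , i , _ , c , n₀ , fast) = M , decides , sublinear
  where
  sublinear : ∀ c′ → ∃ λ n₁ → ∀ x → n₁ ≤ length x →
              ∃ λ t → c′ * t ≤ length x × HaltsWithin M x t (P x)
  sublinear c′ with polylog≤id (c′ * c) i
  ... | n₂ , small = n₀ + n₂ , λ x le →
    c * ⌊log₂ length x ⌋ ^ i ,
    subst (_≤ length x) (*-assoc c′ c _) (small (length x) (≤-trans (m≤n+m n₂ n₀) le)) ,
    fast x (≤-trans (m≤m+n n₀ n₂) le)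

-- Among the cells 0, …, T some cell p is not a value f t for t < T
-- (pigeonhole: otherwise choosing such t would inject Fin (T+1) into Fin T).
unvisited : (f : ℕ → ℕ) (T : ℕ) → ∃ λ p → p ≤ T × (∀ t → t < T → f t ≢ p)
unvisited f T = toℕ p , toℕ≤pred[n] p , λ t t<T ft≡p → p-unvisited (fromℕ< t<T , trans (cong f (toℕ-fromℕ< t<T)) ft≡p)
  where
  Visited : Fin (suc T) → Set
  Visited p = ∃ λ (t : Fin T) → f (toℕ t) ≡ toℕ p

  not-all-visited : ¬ (∀ p → Visited p)
  not-all-visited visited = 1+n≰n (injective⇒≤ {f = time} time-injective)
    where
    time : Fin (suc T) → Fin T
    time p = proj₁ (visited p)
    time-injective : ∀ {p q} → time p ≡ time q → p ≡ q
    time-injective {p} {q} eq = toℕ-injective (begin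
      toℕ p               ≡⟨ sym (proj₂ (visited p)) ⟩
      f (toℕ (time p))    ≡⟨ cong (f ∘ toℕ) eq ⟩
      f (toℕ (time q))    ≡⟨ proj₂ (visited q) ⟩
      toℕ q               ∎)
      where open ≡-Reasoning

  -- Visited is decidable, so some p is not visited
  found : ∃ λ p → ¬ Visited p
  found = ¬∀⟶∃¬ (suc T) Visited (λ p → any? λ t → f (toℕ t) ℕ.≟ toℕ p) not-all-visited
  p : Fin (suc T)
  p = proj₁ found
  p-unvisited : ¬ Visited p
  p-unvisited = proj₂ found

update-self : ∀ {A : Set} (f : ℕ → A) h i → update f h (f h) i ≡ f i
update-self f h i with i ℕ.≡ᵇ h in e
... | true  = cong f (sym (≡ᵇ⇒≡ i h (subst Bool.T (sym e) tt)))
... | false = refl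

-- One step of M from c, taken as if in state q reading input symbol r and
-- writable-tape symbols σ; step′ is the instance with the values actually read.
stepWith : (M : RATM) → Fin (RATM.nQ M) → Maybe Bool →
           (Fin (suc (RATM.w M)) → Fin (suc (RATM.s M))) → Config M → Config M
stepWith M q r σ c =
  if does (Action.next a ≟ RATM.qₐ M)
  then record c′ { inHead = address (idx zero)
                 ; wHead = λ i → address (idx (suc i)) }
  else c′
  where
    open Config c
    a : Action (RATM.nQ M) (RATM.s M) (RATM.w M)
    a = RATM.δ M q r σ
    idx : Fin (2 + RATM.w M) → List (Maybe Bool)
    idx j = setAt (idxTape j) (idxHead j) (Action.idxWrite a j)
    c′ : Config M
    c′ = record
      { state   = Action.next a
      ; inHead  = move (Action.inMove a) inHead
      ; wTape   = λ i → update (wTape i) (wHead i) (Action.write a i)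
      ; wHead   = λ i → move (Action.wMove a i) (wHead i)
      ; idxTape = idx
      ; idxHead = λ j → move (Action.idxMove a j) (idxHead j) }

reads : {M : RATM} → Config M → Fin (suc (RATM.w M)) → Fin (suc (RATM.s M))
reads c i = Config.wTape c i (Config.wHead c i)

step-unfold : ∀ M x (c : Config M) → result c ≡ nothing →
              step M x c ≡ stepWith M (Config.state c) (nth x (Config.inHead c)) (reads c) c
step-unfold M x c running with result c
... | nothing = refl

step-local : ∀ M x y (c : Config M) → nth x (Config.inHead c) ≡ nth y (Config.inHead c) →
             step M x c ≡ step M y c
step-local M x y c same with result c
... | nothing = cong (λ r → stepWith M (Config.state c) r (reads c) c) same
... | just _  = refl

run-local : ∀ M x y p T → (∀ q → q ≢ p → nth x q ≡ nth y q) →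
            (∀ t → t < T → Config.inHead (run M y t) ≢ p) → run M x T ≡ run M y T
run-local M x y p zero    agree avoids = refl
run-local M x y p (suc T) agree avoids = begin
  step M x (run M x T)    ≡⟨ cong (step M x) (run-local M x y p T agree (λ t t<T → avoids t (m≤n⇒m≤1+n t<T))) ⟩
  step M x (run M y T)    ≡⟨ step-local M x y (run M y T) (agree _ (avoids T ≤-refl)) ⟩
  step M y (run M y T)    ∎
  where open ≡-Reasoning

unread-cell : ∀ M y T → ∃ λ p → p ≤ T ×
              (∀ x → (∀ q → q ≢ p → nth x q ≡ nth y q) → run M x T ≡ run M y T)
unread-cell M y T with unvisited (λ t → Config.inHead (run M y t)) T
... | p , p≤T , avoids = p , p≤T , λ x agree → run-local M x y p T agree avoids

onesFrom : List Bool → ℕ → ℕ → Bool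
onesFrom x i d with nth x i | d
... | nothing    | _     = true
... | just false | _     = false
... | just true  | zero  = true
... | just true  | suc e = onesFrom x (suc i) e

-- The length of the scanned window is 2^counterExp n, about 2√n.
counterExp : ℕ → ℕ
counterExp n = suc ⌊ ⌈log₂ n ⌉ /2⌋

Ones : Problem
Ones x = onesFrom x 0 (2 ^ counterExp (length x))

-- Every number is even or odd; the probing phase alternates between the two.
data EvenOdd : ℕ → Set where
  even : ∀ u → EvenOdd (u + u)
  odd  : ∀ u → EvenOdd (suc (u + u))

evenOdd : ∀ K → EvenOdd K
evenOdd zero          = even zero
evenOdd (suc zero)    = odd zero
evenOdd (suc (suc K)) with evenOdd K
... | even u = subst EvenOdd (cong suc (+-suc u u)) (even (suc u))
... | odd u  = subst EvenOdd (cong (suc ∘′ suc) (+-suc u u)) (odd (suc u))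

⌊u+u/2⌋≡u : ∀ u → ⌊ u + u /2⌋ ≡ u
⌊u+u/2⌋≡u u = sym (n≡⌊n+n/2⌋ u)

⌊1+u+u/2⌋≡u : ∀ u → ⌊ suc (u + u) /2⌋ ≡ u
⌊1+u+u/2⌋≡u zero    = refl
⌊1+u+u/2⌋≡u (suc u) = cong suc (trans (cong ⌊_/2⌋ (+-suc u u)) (⌊1+u+u/2⌋≡u u))

-- Besides the input tape it uses the output tape as a
-- counter (a mark in cell 0, blanks elsewhere) and one work tape as a register whose
-- cell 0 records the phase; index tape 2 (the register's) always holds address 0.
State : Set
State = Fin 7

pattern init₀  = zero
pattern init₁  = suc zero
pattern probe  = suc (suc zero)
pattern rewind = suc (suc (suc zero))
pattern scan   = suc (suc (suc (suc zero)))
pattern accept = suc (suc (suc (suc (suc zero))))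
pattern reject = suc (suc (suc (suc (suc (suc zero)))))

Symbol : Set
Symbol = Fin 5

pattern blank     = zero
pattern mark      = suc zero
pattern oddPhase  = suc (suc zero)
pattern evenPhase = suc (suc (suc zero))
pattern scanPhase = suc (suc (suc (suc zero)))

-- act q m s ms ph iw im cw cm: go to q, move the input head by m, write s on the
-- counter and move it by ms, write ph in the register, write iw on the input
-- index tape and move it by im, write cw on the counter index tape and move it by cm.
act : State → Move → Symbol → Move → Symbol → Maybe Bool → Move → Maybe Bool → Move → Action 7 4 1
act q m s ms ph iw im cw cm = record
  { next = q ; inMove = m
  ; write    = λ { zero → s ; (suc zero) → ph }
  ; wMove    = λ { zero → ms ; (suc zero) → stay }
  ; idxWrite = λ { zero → iw ; (suc zero) → cw ; (suc (suc zero)) → nothing }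
  ; idxMove  = λ { zero → im ; (suc zero) → cm ; (suc (suc zero)) → stay } }

scanAct : Maybe Bool → Symbol → Action 7 4 1
scanAct (just false) s    = act reject stay s stay scanPhase nothing stay nothing stay
scanAct nothing      s    = act accept stay s stay scanPhase nothing stay nothing stay
scanAct (just true)  mark = act accept stay mark stay scanPhase nothing stay nothing stay
scanAct (just true)  s    = act scan right s left scanPhase nothing stay nothing stay

-- Probing 2^j appends a 0 to the input index (so the next jump goes to 2^(j+1)) and,
-- every second probe, a 0 to the counter index; on a blank it starts rewinding, moving
-- the counter head from 2^h down to the mark and the input index head back to cell 0,
-- where it erases the index; the jump then starts the scan at input cell 0 with the
-- counter head back on 2^h.
δ′ : State → Maybe Bool → Symbol → Symbol → Action 7 4 1
δ′ init₀  _        _    _         = act init₁ stay mark stay evenPhase (just true) stay (just true) right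
δ′ init₁  _        s    _         = act probe stay s stay evenPhase (just true) right (just false) right
δ′ probe  r        s    scanPhase = scanAct r s
δ′ probe  nothing  s    _         = act rewind stay s left scanPhase nothing left nothing stay
δ′ probe  (just _) s    oddPhase  = act probe stay s stay evenPhase (just false) right (just false) right
δ′ probe  (just _) s    _         = act probe stay s stay oddPhase (just false) right nothing stay
δ′ rewind _        mark _         = act probe stay mark left scanPhase nothing left nothing stay
δ′ rewind _        s    _         = act rewind stay s left scanPhase nothing left nothing stay
δ′ scan   r        s    _         = scanAct r s
δ′ accept _        s    ph        = act accept stay s stay ph nothing stay nothing stay
δ′ reject _        s    ph        = act reject stay s stay ph nothing stay nothing stay

Onesₘ : RATM
Onesₘ = record
  { nQ = 7 ; s = 4 ; w = 1 ; q₀ = init₀ ; qₐ = probe ; qacc = accept ; qrej = reject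
  ; acc≢rej = λ ()
  ; δ = λ q r σ → δ′ q r (σ zero) (σ (suc zero)) }

Cfg : Set
Cfg = Config Onesₘ

sees : Symbol → Symbol → Fin 2 → Symbol
sees s ph zero       = s
sees s ph (suc zero) = ph

verdict : State → Maybe Bool
verdict q = if does (q ≟ accept) then just true else if does (q ≟ reject) then just false else nothing

step≡ : ∀ x (c : Cfg) {q r s ph} → Config.state c ≡ q → verdict q ≡ nothing →
        nth x (Config.inHead c) ≡ r → reads c zero ≡ s → reads c (suc zero) ≡ ph →
        step Onesₘ x c ≡ stepWith Onesₘ q r (sees s ph) c
step≡ x c refl running refl refl refl = step-unfold Onesₘ x c running

counterTape : ℕ → Symbol
counterTape zero    = mark
counterTape (suc _) = blank

-- Invariant kept from time 2 on: the counter tape is untouched, and the register head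
-- rests on cell 0, which holds the phase ph, with the register index tape blank at 0.
record Frame (c : Cfg) (ph : Symbol) : Set where
  field
    counter    : ∀ p → Config.wTape c zero p ≡ counterTape p
    regPos     : Config.wHead c (suc zero) ≡ 0
    regCell    : Config.wTape c (suc zero) 0 ≡ ph
    regIdx     : Config.idxTape c (suc (suc zero)) ≡ nothing ∷ []
    regIdxPos  : Config.idxHead c (suc (suc zero)) ≡ 0

-- What a step does to the parts of the frame, given that it writes back the
-- counter symbol it reads and writes nothing on the register index tape.
module FrameStep {c : Cfg} {ph : Symbol} (F : Frame c ph) where
  open Frame F
  open Config c

  counter-kept : ∀ {s} → reads c zero ≡ s → ∀ p → update (wTape zero) (wHead zero) s p ≡ counterTape p
  counter-kept {s} read p =
    subst (λ s → update (wTape zero) (wHead zero) s p ≡ counterTape p) read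
          (trans (update-self (wTape zero) (wHead zero) p) (counter p))

  phase-set : ∀ ph′ → update (wTape (suc zero)) (wHead (suc zero)) ph′ 0 ≡ ph′
  phase-set ph′ rewrite regPos = refl

  regIdx-kept : setAt (idxTape (suc (suc zero))) (idxHead (suc (suc zero))) nothing ≡ nothing ∷ []
  regIdx-kept rewrite regIdx | regIdxPos = refl

  regPos-after-jump : address (setAt (idxTape (suc (suc zero))) (idxHead (suc (suc zero))) nothing) ≡ 0
  regPos-after-jump = cong address regIdx-kept

  counter-read : ∀ {p} → wHead zero ≡ p → reads c zero ≡ counterTape p
  counter-read at = trans (counter (wHead zero)) (cong counterTape at)

  phase-read : reads c (suc zero) ≡ ph
  phase-read = trans (cong (wTape (suc zero)) regPos) regCell

-- The index-tape word 1 0^j, the binary address 2^j.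
code : ℕ → List (Maybe Bool)
code j = just true ∷ replicate j (just false)

|code| : ∀ j → length (code j) ≡ suc j
|code| j = cong suc (length-replicate j)

code-suc : ∀ j → code j ++ just false ∷ [] ≡ code (suc j)
code-suc j = cong (just true ∷_) (zeros-snoc j)
  where
  zeros-snoc : ∀ j → replicate j (just false) ++ just false ∷ [] ≡ just false ∷ replicate j (just false)
  zeros-snoc zero    = refl
  zeros-snoc (suc j) = cong (just false ∷_) (zeros-snoc j)

setAt-end : ∀ xs {n} → length xs ≡ n → ∀ v → setAt xs n v ≡ xs ++ v ∷ []
setAt-end []       refl v = refl
setAt-end (x ∷ xs) refl v = cong (x ∷_) (setAt-end xs refl v)

setAt-last : ∀ xs {n} → length xs ≡ n → ∀ w v → setAt (xs ++ w ∷ []) n v ≡ xs ++ v ∷ []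
setAt-last []       refl w v = refl
setAt-last (x ∷ xs) refl w v = cong (x ∷_) (setAt-last xs refl w v)

addrFrom-zeros : ∀ j a R → addrFrom a (replicate j (just false) ++ R) ≡ addrFrom (2 ^ j * a) R
addrFrom-zeros zero    a R = cong (λ a → addrFrom a R) (sym (+-identityʳ a))
addrFrom-zeros (suc j) a R = trans (addrFrom-zeros j (2 * a + 0) R) (cong (λ a → addrFrom a R) doubled)
  where
  doubled : 2 ^ j * (2 * a + 0) ≡ 2 ^ suc j * a
  doubled = trans (cong (2 ^ j *_) (+-identityʳ (2 * a)))
                  (trans (sym (*-assoc (2 ^ j) 2 a)) (cong (_* a) (*-comm (2 ^ j) 2)))

address-code : ∀ j → address (code j) ≡ 2 ^ j
address-code j = trans (cong (addrFrom 1) (sym (++-identityʳ (replicate j (just false)))))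
                       (trans (addrFrom-zeros j 1 []) (*-identityʳ (2 ^ j)))

address-code-blank : ∀ j → address (code j ++ nothing ∷ []) ≡ 2 ^ j
address-code-blank j = trans (addrFrom-zeros j 1 (nothing ∷ [])) (*-identityʳ (2 ^ j))

record Probing (j h : ℕ) (ph : Symbol) (idx : List (Maybe Bool)) (c : Cfg) : Set where
  field
    st        : Config.state c ≡ probe
    inPos     : Config.inHead c ≡ 2 ^ j
    inIdx     : Config.idxTape c zero ≡ code j
    inIdxPos  : Config.idxHead c zero ≡ suc j
    ctrPos    : Config.wHead c zero ≡ 2 ^ h
    ctrIdx    : Config.idxTape c (suc zero) ≡ idx
    ctrIdxPos : Config.idxHead c (suc zero) ≡ suc h
    frame     : Frame c ph

-- After 2m probes the counter index reads 2^(m+1); after 2m+1 it reads the same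
-- address, but with a blank already written where the next 0 will go.
ProbingEven : ℕ → Cfg → Set
ProbingEven m = Probing (m + m) (suc m) evenPhase (code (suc m))

ProbingOdd : ℕ → Cfg → Set
ProbingOdd m = Probing (suc (m + m)) (suc m) oddPhase (code (suc m) ++ nothing ∷ [])

-- The two initial steps mark counter cell 0, write 1 on both index tapes and a 0 on the
-- counter's, and jump: the machine probes 2^0 with the counter head on 2^1.
initialised : ∀ x → ProbingEven 0 (run Onesₘ x 2)
initialised x = record
  { st = refl ; inPos = refl ; inIdx = refl ; inIdxPos = refl ; ctrPos = refl ; ctrIdx = refl ; ctrIdxPos = refl
  ; frame = record { counter = λ { zero → refl ; (suc p) → refl }
                   ; regPos = refl ; regCell = refl ; regIdx = refl ; regIdxPos = refl } }

counter-blank : ∀ {c ph} → Frame c ph → ∀ {p} → Config.wHead c zero ≡ p → 0 < p → reads c zero ≡ blank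
counter-blank F {suc p} at _ = FrameStep.counter-read F at

next-inIdx : ∀ {j h ph idx c} → Probing j h ph idx c →
             setAt (Config.idxTape c zero) (Config.idxHead c zero) (just false) ≡ code (suc j)
next-inIdx {j} P = trans (cong₂ (λ L k → setAt L k (just false)) (Probing.inIdx P) (Probing.inIdxPos P))
                         (trans (setAt-end (code j) (|code| j) (just false)) (code-suc j))

probe-even : ∀ x m c b → ProbingEven m c → nth x (2 ^ (m + m)) ≡ just b → ProbingOdd m (step Onesₘ x c)
probe-even x m c b P read = subst (ProbingOdd m) (sym stepped) (record
    { st        = refl
    ; inPos     = trans (cong address inIdx′) (address-code (suc j))
    ; inIdx     = inIdx′
    ; inIdxPos  = cong suc inIdxPos
    ; ctrPos    = trans (cong address ctrIdx′) (address-code-blank (suc m))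
    ; ctrIdx    = ctrIdx′
    ; ctrIdxPos = ctrIdxPos
    ; frame     = record { counter = counter-kept s≡blank ; regPos = regPos-after-jump ; regCell = phase-set oddPhase
                         ; regIdx = regIdx-kept ; regIdxPos = Frame.regIdxPos frame } })
  where
  open Probing P
  open FrameStep frame
  j = m + m
  s≡blank : reads c zero ≡ blank
  s≡blank = counter-blank frame ctrPos (m^n>0 2 (suc m))
  stepped : step Onesₘ x c ≡ stepWith Onesₘ probe (just b) (sees blank evenPhase) c
  stepped = step≡ x c st refl (trans (cong (nth x) inPos) read) s≡blank phase-read
  inIdx′ : setAt (Config.idxTape c zero) (Config.idxHead c zero) (just false) ≡ code (suc j)
  inIdx′ = next-inIdx P
  ctrIdx′ : setAt (Config.idxTape c (suc zero)) (Config.idxHead c (suc zero)) nothing ≡ code (suc m) ++ nothing ∷ []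
  ctrIdx′ = trans (cong₂ (λ L k → setAt L k nothing) ctrIdx ctrIdxPos) (setAt-end (code (suc m)) (|code| (suc m)) nothing)

probe-odd : ∀ x m c b → ProbingOdd m c → nth x (2 ^ suc (m + m)) ≡ just b → ProbingEven (suc m) (step Onesₘ x c)
probe-odd x m c b P read =
  subst (ProbingEven (suc m)) (sym stepped)
        (subst (λ j′ → Probing j′ (suc (suc m)) evenPhase (code (suc (suc m))) c′) (cong suc (sym (+-suc m m))) advanced)
  where
  open Probing P
  open FrameStep frame
  j = suc (m + m)
  s≡blank : reads c zero ≡ blank
  s≡blank = counter-blank frame ctrPos (m^n>0 2 (suc m))
  stepped : step Onesₘ x c ≡ stepWith Onesₘ probe (just b) (sees blank oddPhase) c
  stepped = step≡ x c st refl (trans (cong (nth x) inPos) read) s≡blank phase-read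
  inIdx′ : setAt (Config.idxTape c zero) (Config.idxHead c zero) (just false) ≡ code (suc j)
  inIdx′ = next-inIdx P
  ctrIdx′ : setAt (Config.idxTape c (suc zero)) (Config.idxHead c (suc zero)) (just false) ≡ code (suc (suc m))
  ctrIdx′ = trans (cong₂ (λ L k → setAt L k (just false)) ctrIdx ctrIdxPos)
                  (trans (setAt-last (code (suc m)) (|code| (suc m)) nothing (just false)) (code-suc (suc m)))
  c′ = stepWith Onesₘ probe (just b) (sees blank oddPhase) c
  advanced : Probing (suc j) (suc (suc m)) evenPhase (code (suc (suc m))) c′
  advanced = record
    { st        = refl
    ; inPos     = trans (cong address inIdx′) (address-code (suc j))
    ; inIdx     = inIdx′
    ; inIdxPos  = cong suc inIdxPos
    ; ctrPos    = trans (cong address ctrIdx′) (address-code (suc (suc m)))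
    ; ctrIdx    = ctrIdx′
    ; ctrIdxPos = cong suc ctrIdxPos
    ; frame     = record { counter = counter-kept s≡blank ; regPos = regPos-after-jump ; regCell = phase-set evenPhase
                         ; regIdx = regIdx-kept ; regIdxPos = Frame.regIdxPos frame } }

-- Rewinding, m steps after it started (on the probe of 2^K finding a blank): the
-- counter head is at 2^h - (m+1), the input index head at K - m, and the counter
-- index tape holds 1 0^h followed by a blank.
record Rewinding (K h m : ℕ) (c : Cfg) : Set where
  field
    st        : Config.state c ≡ rewind
    ctrPos    : Config.wHead c zero ≡ 2 ^ h ∸ suc m
    inIdxPos  : Config.idxHead c zero ≡ K ∸ m
    ctrIdx    : Config.idxTape c (suc zero) ≡ code h ++ nothing ∷ []
    ctrIdxPos : Config.idxHead c (suc zero) ≡ suc h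
    frame     : Frame c scanPhase

move-left-∸ : ∀ n k → move left (n ∸ k) ≡ n ∸ suc k
move-left-∸ n k = trans (move-left (n ∸ k)) (pred[m∸n]≡m∸[1+n] n k)
  where
  move-left : ∀ m → move left m ≡ pred m
  move-left zero    = refl
  move-left (suc m) = refl

probe-blank : ∀ x j h ph idx c → ph ≡ oddPhase ⊎ ph ≡ evenPhase → Probing j h ph idx c →
              setAt idx (suc h) nothing ≡ code h ++ nothing ∷ [] → nth x (2 ^ j) ≡ nothing →
              Rewinding j h 0 (step Onesₘ x c)
probe-blank x j h ph idx c probing P blanked read = subst (Rewinding j h 0) (sym (stepped probing)) started
  where
  open Probing P
  open FrameStep frame
  s≡blank : reads c zero ≡ blank
  s≡blank = counter-blank frame ctrPos (m^n>0 2 h)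
  -- from a probing phase, reading a blank, the step does not depend on the phase
  stepped : ph ≡ oddPhase ⊎ ph ≡ evenPhase → step Onesₘ x c ≡ stepWith Onesₘ probe nothing (sees blank evenPhase) c
  stepped (inj₁ refl) = step≡ x c st refl (trans (cong (nth x) inPos) read) s≡blank phase-read
  stepped (inj₂ refl) = step≡ x c st refl (trans (cong (nth x) inPos) read) s≡blank phase-read
  started : Rewinding j h 0 (stepWith Onesₘ probe nothing (sees blank evenPhase) c)
  started = record
    { st        = refl
    ; ctrPos    = trans (cong (move left) ctrPos) (move-left-∸ (2 ^ h) 0)
    ; inIdxPos  = cong (move left) inIdxPos
    ; ctrIdx    = trans (cong₂ (λ L k → setAt L k nothing) ctrIdx ctrIdxPos) blanked
    ; ctrIdxPos = ctrIdxPos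
    ; frame     = record { counter = counter-kept s≡blank ; regPos = Frame.regPos frame ; regCell = phase-set scanPhase
                         ; regIdx = regIdx-kept ; regIdxPos = Frame.regIdxPos frame } }

rewind-step : ∀ x K h m c → Rewinding K h m c → suc m < 2 ^ h → Rewinding K h (suc m) (step Onesₘ x c)
rewind-step x K h m c R m+1<2^h = subst (Rewinding K h (suc m)) (sym stepped) (record
    { st        = refl
    ; ctrPos    = trans (cong (move left) ctrPos) (move-left-∸ (2 ^ h) (suc m))
    ; inIdxPos  = trans (cong (move left) inIdxPos) (move-left-∸ K m)
    ; ctrIdx    = trans (cong₂ (λ L k → setAt L k nothing) ctrIdx ctrIdxPos) (setAt-last (code h) (|code| h) nothing nothing)
    ; ctrIdxPos = ctrIdxPos
    ; frame     = record { counter = counter-kept s≡blank ; regPos = Frame.regPos frame ; regCell = phase-set scanPhase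
                         ; regIdx = regIdx-kept ; regIdxPos = Frame.regIdxPos frame } })
  where
  open Rewinding R
  open FrameStep frame
  s≡blank : reads c zero ≡ blank
  s≡blank = counter-blank frame ctrPos (m<n⇒0<n∸m m+1<2^h)
  stepped : step Onesₘ x c ≡ stepWith Onesₘ rewind (nth x (Config.inHead c)) (sees blank scanPhase) c
  stepped = step≡ x c st refl refl s≡blank phase-read

-- Scanning cell i: the machine is in the probe state (right after the jump) or the
-- scan state, with the input head on i and the counter head on 2^h - i.
record Scanning (h i : ℕ) (c : Cfg) : Set where
  field
    st     : Config.state c ≡ probe ⊎ Config.state c ≡ scan
    inPos  : Config.inHead c ≡ i
    ctrPos : Config.wHead c zero ≡ 2 ^ h ∸ i
    frame  : Frame c scanPhase

-- When the counter head reaches the mark, the input index head has reached cell 0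
-- (as K ≤ m); erasing that cell and jumping starts the scan at input cell 0.
rewind-end : ∀ x K h m c → Rewinding K h m c → suc m ≡ 2 ^ h → K ≤ m → Scanning h 0 (step Onesₘ x c)
rewind-end x K h m c R m+1≡2^h K≤m = subst (Scanning h 0) (sym stepped) (record
    { st     = inj₁ refl
    ; inPos  = trans (cong (λ k → address (setAt (Config.idxTape c zero) k nothing)) (trans inIdxPos (m≤n⇒m∸n≡0 K≤m)))
                     (erased (Config.idxTape c zero))
    ; ctrPos = trans (cong₂ (λ L k → address (setAt L k nothing)) ctrIdx ctrIdxPos)
                     (trans (cong address (setAt-last (code h) (|code| h) nothing nothing)) (address-code-blank h))
    ; frame  = record { counter = counter-kept s≡mark ; regPos = regPos-after-jump ; regCell = phase-set scanPhase
                      ; regIdx = regIdx-kept ; regIdxPos = Frame.regIdxPos frame } })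
  where
  open Rewinding R
  open FrameStep frame
  erased : ∀ L → address (setAt L 0 nothing) ≡ 0
  erased []      = refl
  erased (_ ∷ _) = refl
  s≡mark : reads c zero ≡ mark
  s≡mark = counter-read (trans ctrPos (trans (cong (_∸ suc m) (sym m+1≡2^h)) (n∸n≡0 (suc m))))
  stepped : step Onesₘ x c ≡ stepWith Onesₘ rewind (nth x (Config.inHead c)) (sees mark scanPhase) c
  stepped = step≡ x c st refl refl s≡mark phase-read

scanning-step : ∀ x h i c → Scanning h i c → ∀ {r s} → nth x i ≡ r → reads c zero ≡ s →
                step Onesₘ x c ≡ stepWith Onesₘ scan r (sees s scanPhase) c
scanning-step x h i c S read s-read with Scanning.st S
... | inj₁ at-probe = step≡ x c at-probe refl (trans (cong (nth x) (Scanning.inPos S)) read) s-read (FrameStep.phase-read (Scanning.frame S))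
... | inj₂ at-scan  = step≡ x c at-scan  refl (trans (cong (nth x) (Scanning.inPos S)) read) s-read (FrameStep.phase-read (Scanning.frame S))

scan-advance : ∀ x h i c → Scanning h i c → nth x i ≡ just true → i < 2 ^ h → Scanning h (suc i) (step Onesₘ x c)
scan-advance x h i c S read i<2^h = subst (Scanning h (suc i)) (sym (scanning-step x h i c S read s≡blank)) (record
    { st     = inj₂ refl
    ; inPos  = cong suc inPos
    ; ctrPos = trans (cong (move left) ctrPos) (move-left-∸ (2 ^ h) i)
    ; frame  = record { counter = counter-kept s≡blank ; regPos = Frame.regPos frame ; regCell = phase-set scanPhase
                      ; regIdx = regIdx-kept ; regIdxPos = Frame.regIdxPos frame } })
  where
  open Scanning S
  open FrameStep frame
  s≡blank : reads c zero ≡ blank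
  s≡blank = counter-blank frame ctrPos (m<n⇒0<n∸m i<2^h)

scanning : ∀ x h d i t → i + d ≡ 2 ^ h → Scanning h i (run Onesₘ x t) →
           ∃ λ t′ → t′ ≤ suc (d + t) × HaltsWithin Onesₘ x t′ (onesFrom x i d)
scanning x h d i t i+d≡2^h S with nth x i in read
... | nothing    = suc t , s≤s (m≤n+m t d) , cong result (scanning-step x h i _ S read refl)
... | just false = suc t , s≤s (m≤n+m t d) , cong result (scanning-step x h i _ S read refl)
scanning x h zero i t i≡2^h S | just true =
  suc t , ≤-refl , cong result (scanning-step x h i _ S read at-mark)
  where
  at-mark : reads (run Onesₘ x t) zero ≡ mark
  at-mark = FrameStep.counter-read (Scanning.frame S)
              (trans (Scanning.ctrPos S) (trans (cong (2 ^ h ∸_) (trans (sym (+-identityʳ i)) i≡2^h)) (n∸n≡0 (2 ^ h))))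
scanning x h (suc d) i t i+d≡2^h S | just true
  with scanning x h d (suc i) (suc t) (trans (sym (+-suc i d)) i+d≡2^h)
                (scan-advance x h i _ S read (subst (i <_) i+d≡2^h (m<m+n i z<s)))
... | t′ , t′≤ , halts = t′ , subst (t′ ≤_) (cong suc (+-suc d t)) t′≤ , halts

K[_] : List Bool → ℕ
K[ x ] = ⌈log₂ length x ⌉

probed-cell : ∀ x j → j < K[ x ] → ∃ λ b → nth x (2 ^ j) ≡ just b
probed-cell x j j<K with K[ x ] in e
probed-cell x j (s≤s j≤k) | suc k = inside x (2 ^ j) (≤-<-trans (^-monoʳ-≤ 2 j≤k) (2^k<n (length x) k e))
  where
  inside : ∀ (x : List Bool) i → i < length x → ∃ λ b → nth x i ≡ just b
  inside (b ∷ x) zero    _         = b , refl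
  inside (b ∷ x) (suc i) (s≤s i<n) = inside x i i<n

blank-at-2^K : ∀ x → nth x (2 ^ K[ x ]) ≡ nothing
blank-at-2^K x = outside x _ (n≤2^⌈log₂n⌉ (length x))
  where
  outside : ∀ (x : List Bool) i → length x ≤ i → nth x i ≡ nothing
  outside []      i       _         = refl
  outside (b ∷ x) (suc i) (s≤s n≤i) = outside x i n≤i

probing-even : ∀ x m → m + m ≤ K[ x ] → ProbingEven m (run Onesₘ x (2 + (m + m)))
probing-odd  : ∀ x m → suc (m + m) ≤ K[ x ] → ProbingOdd m (run Onesₘ x (3 + (m + m)))
probing-even x zero    _  = initialised x
probing-even x (suc m) le =
  subst (λ t → ProbingEven (suc m) (run Onesₘ x t)) (cong (3 +_) (sym (+-suc m m)))
        (probe-odd x m _ (proj₁ cell) (probing-odd x m (<⇒≤ le′)) (proj₂ cell))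
  where
  le′ : suc (suc (m + m)) ≤ K[ x ]
  le′ = subst (_≤ K[ x ]) (cong suc (+-suc m m)) le
  cell : ∃ λ b → nth x (2 ^ suc (m + m)) ≡ just b
  cell = probed-cell x (suc (m + m)) le′
probing-odd x m le = probe-even x m _ (proj₁ cell) (probing-even x m (<⇒≤ le)) (proj₂ cell)
  where
  cell : ∃ λ b → nth x (2 ^ (m + m)) ≡ just b
  cell = probed-cell x (m + m) le

rewinding-start : ∀ x → Rewinding K[ x ] (counterExp (length x)) 0 (run Onesₘ x (3 + K[ x ]))
rewinding-start x = from (evenOdd K[ x ]) refl
  where
  blank-at : ∀ {K} → K[ x ] ≡ K → nth x (2 ^ K) ≡ nothing
  blank-at refl = blank-at-2^K x
  from : ∀ {K} → EvenOdd K → K[ x ] ≡ K → Rewinding K[ x ] (counterExp (length x)) 0 (run Onesₘ x (3 + K[ x ]))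
  from (even u) e rewrite e | ⌊u+u/2⌋≡u u =
    probe-blank x (u + u) (suc u) evenPhase (code (suc u)) _ (inj₂ refl) (probing-even x u (≤-reflexive (sym e)))
                (setAt-end (code (suc u)) (|code| (suc u)) nothing) (blank-at e)
  from (odd u) e rewrite e | ⌊1+u+u/2⌋≡u u =
    probe-blank x (suc (u + u)) (suc u) oddPhase (code (suc u) ++ nothing ∷ []) _ (inj₁ refl) (probing-odd x u (≤-reflexive (sym e)))
                (setAt-last (code (suc u)) (|code| (suc u)) nothing nothing) (blank-at e)

rewinding : ∀ x K h t m → suc m ≤ 2 ^ h → Rewinding K h 0 (run Onesₘ x t) → Rewinding K h m (run Onesₘ x (m + t))
rewinding x K h t zero    _  R = R
rewinding x K h t (suc m) le R = rewind-step x K h m _ (rewinding x K h t m (<⇒≤ le) R) le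

-- The counter outlasts the rewinding of the input index: K < 2^(1 + ⌊K/2⌋).
K<2^[1+⌊K/2⌋] : ∀ K → K < 2 ^ suc ⌊ K /2⌋
K<2^[1+⌊K/2⌋] K = from (evenOdd K)
  where
  from : ∀ {K} → EvenOdd K → K < 2 ^ suc ⌊ K /2⌋
  from (even u) rewrite ⌊u+u/2⌋≡u u =
    subst (suc (u + u) ≤_) (sym (2^[1+k]≡2^k+2^k u)) (+-mono-≤ (1+k≤2^k u) (k≤2^k u))
  from (odd u) rewrite ⌊1+u+u/2⌋≡u u =
    subst₂ _≤_ (cong suc (+-suc u u)) (sym (2^[1+k]≡2^k+2^k u)) (+-mono-≤ (1+k≤2^k u) (1+k≤2^k u))

-- Correctness and running time: the machine answers Ones x within 5·2^counterExp n steps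
-- (K + 3 steps until rewinding starts, 2^H - 1 rewinding, the jump, at most 2^H + 1 scanning).
Onesₘ-decides : ∀ x → ∃ λ t → t ≤ 5 * 2 ^ counterExp (length x) × HaltsWithin Onesₘ x t (Ones x)
Onesₘ-decides x =
  let t , t≤ , halts = scanning x H (2 ^ H) 0 t₀ refl scan-start in t , ≤-trans t≤ total , halts
  where
  K = K[ x ]
  H = counterExp (length x)
  m = pred (2 ^ H)
  1+m≡2^H : suc m ≡ 2 ^ H
  1+m≡2^H = suc-pred (2 ^ H) {{m^n≢0 2 H}}
  t₀ = suc (m + (3 + K))
  scan-start : Scanning H 0 (run Onesₘ x t₀)
  scan-start = rewind-end x K H m _ (rewinding x K H (3 + K) m (≤-reflexive 1+m≡2^H) (rewinding-start x)) 1+m≡2^H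
                 (s≤s⁻¹ (subst (suc K ≤_) (sym 1+m≡2^H) (K<2^[1+⌊K/2⌋] K)))
  total : suc (2 ^ H + t₀) ≤ 5 * 2 ^ H
  total = begin
    suc (p + suc (m + (3 + K)))    ≡⟨ solve 3 (λ p m K → con 1 :+ (p :+ (con 1 :+ (m :+ (con 3 :+ K))))
                                                   := p :+ ((con 1 :+ m) :+ (con 3 :+ (con 1 :+ K)))) refl p m K ⟩
    p + (suc m + (3 + suc K))      ≤⟨ +-monoʳ-≤ p (+-mono-≤ (≤-reflexive 1+m≡2^H) (+-mono-≤ 3≤p+p (K<2^[1+⌊K/2⌋] K))) ⟩
    p + (p + ((p + p) + p))        ≡⟨ solve 1 (λ p → p :+ (p :+ ((p :+ p) :+ p)) := con 5 :* p) refl p ⟩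
    5 * p                          ∎
    where
    open ≤-Reasoning
    p = 2 ^ H
    3≤p+p : 3 ≤ p + p
    3≤p+p = ≤-trans (n≤1+n 3) (+-mono-≤ 2≤p 2≤p)
      where
      2≤p : 2 ≤ p
      2≤p = ^-monoʳ-≤ 2 {1} {H} (s≤s z≤n)

-- The running time is o(n): c·5·2^counterExp n ≤ n for large n.  With K = ⌈log₂ n⌉ and
-- u = ⌊K/2⌋, twice the left side is 20c·2^u ≤ 2^u·2^u ≤ 2^K ≤ 2n once u ≥ 20c.
window-sublinear : ∀ c → ∃ λ n₀ → ∀ n → n₀ ≤ n → c * (5 * 2 ^ counterExp n) ≤ n
window-sublinear c = 2 ^ suc (A + A) , bound
  where
  A = 20 * c
  bound : ∀ n → 2 ^ suc (A + A) ≤ n → c * (5 * 2 ^ counterExp n) ≤ n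
  bound n le with ⌈log₂ n ⌉ in e | ⌈log₂⌉-≥ {suc (A + A)} {n} le
  ... | suc k | s≤s A+A≤k = *-cancelˡ-≤ 2 (begin
    2 * (c * (5 * (2 * q)))   ≡⟨ solve 2 (λ c q → con 2 :* (c :* (con 5 :* (con 2 :* q))) := (con 20 :* c) :* q) refl c q ⟩
    A * q                     ≤⟨ *-monoˡ-≤ q A≤q ⟩
    q * q                     ≡⟨ sym (^-distribˡ-+-* 2 u u) ⟩
    2 ^ (u + u)               ≤⟨ ^-monoʳ-≤ 2 u+u≤K ⟩
    2 ^ suc k                 ≡⟨ 2^[1+k]≡2^k+2^k k ⟩
    2 ^ k + 2 ^ k             ≤⟨ +-mono-≤ 2^k≤n 2^k≤n ⟩
    n + n                     ≡⟨ cong (n +_) (sym (+-identityʳ n)) ⟩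
    2 * n                     ∎)
    where
    open ≤-Reasoning
    u = ⌊ suc k /2⌋
    q = 2 ^ u
    2^k≤n : 2 ^ k ≤ n
    2^k≤n = <⇒≤ (2^k<n n k e)
    u+u≤K : u + u ≤ suc k
    u+u≤K = subst (u + u ≤_) (⌊n/2⌋+⌈n/2⌉≡n (suc k)) (+-monoʳ-≤ u (⌊n/2⌋≤⌈n/2⌉ (suc k)))
    A≤q : A ≤ q
    A≤q = ≤-trans (k≤2^k A) (^-monoʳ-≤ 2 (subst (_≤ u) (⌊u+u/2⌋≡u A) (⌊n/2⌋-mono (m≤n⇒m≤1+n A+A≤k))))

Ones∈ST : ST Ones
Ones∈ST = Onesₘ , (λ x → let t , _ , halts = Onesₘ-decides x in t , halts) , λ c →
  let n₀ , small = window-sublinear c in n₀ , λ x n₀≤n →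
  let t , t≤ , halts = Onesₘ-decides x in t , ≤-trans (*-monoʳ-≤ c t≤) (small (length x) n₀≤n) , halts

ones-accept : ∀ y → (∀ q → nth y q ≢ just false) → ∀ d i → onesFrom y i d ≡ true
ones-accept y no-zero d i with nth y i in read
... | nothing    = refl
... | just false = ⊥-elim (no-zero i read)
ones-accept y no-zero zero    i | just true = refl
ones-accept y no-zero (suc d) i | just true = ones-accept y no-zero d (suc i)

ones-reject : ∀ x p → nth x p ≡ just false → ∀ d i → i ≤ p → p ≤ i + d →
              (∀ q → i ≤ q → q < p → nth x q ≡ just true) → onesFrom x i d ≡ false
ones-reject x p zero-at-p d i i≤p p≤i+d ones-before with i ℕ.≟ p
... | yes refl rewrite zero-at-p = refl
... | no i≢p = continue d p≤i+d
  where
  i<p : i < p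
  i<p = ≤∧≢⇒< i≤p i≢p
  continue : ∀ d → p ≤ i + d → onesFrom x i d ≡ false
  continue zero    p≤i   = ⊥-elim (<⇒≱ i<p (subst (p ≤_) (+-identityʳ i) p≤i))
  continue (suc d) p≤i+d rewrite ones-before i ≤-refl i<p =
    ones-reject x p zero-at-p d (suc i) i<p (subst (p ≤_) (+-suc i d) p≤i+d) (λ q i<q → ones-before q (<⇒≤ i<q))

overwrite : List Bool → ℕ → Bool → List Bool
overwrite []      _       _ = []
overwrite (a ∷ x) zero    b = b ∷ x
overwrite (a ∷ x) (suc p) b = a ∷ overwrite x p b

overwrite-length : ∀ x p b → length (overwrite x p b) ≡ length x
overwrite-length []      p       b = refl
overwrite-length (a ∷ x) zero    b = refl
overwrite-length (a ∷ x) (suc p) b = cong suc (overwrite-length x p b)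

overwrite-here : ∀ x p b → p < length x → nth (overwrite x p b) p ≡ just b
overwrite-here (a ∷ x) zero    b _         = refl
overwrite-here (a ∷ x) (suc p) b (s≤s p<n) = overwrite-here x p b p<n

overwrite-elsewhere : ∀ x p b q → q ≢ p → nth (overwrite x p b) q ≡ nth x q
overwrite-elsewhere []      p       b q       _   = refl
overwrite-elsewhere (a ∷ x) zero    b zero    q≢p = ⊥-elim (q≢p refl)
overwrite-elsewhere (a ∷ x) zero    b (suc q) _   = refl
overwrite-elsewhere (a ∷ x) (suc p) b zero    _   = refl
overwrite-elsewhere (a ∷ x) (suc p) b (suc q) q≢p = overwrite-elsewhere x p b q (q≢p ∘ cong suc)

nth-ones : ∀ n q → q < n → nth (replicate n true) q ≡ just true
nth-ones (suc n) zero    _         = refl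
nth-ones (suc n) (suc q) (s≤s q<n) = nth-ones n q q<n

ones-no-zero : ∀ n q → nth (replicate n true) q ≢ just false
ones-no-zero zero    q       ()
ones-no-zero (suc n) zero    ()
ones-no-zero (suc n) (suc q) e = ones-no-zero n q e

counterExp-2^[u+u] : ∀ u → counterExp (2 ^ (u + u)) ≡ suc u
counterExp-2^[u+u] u = cong suc (trans (cong ⌊_/2⌋ (⌈log₂2^n⌉≡n (u + u))) (⌊u+u/2⌋≡u u))

Ones-all-ones : ∀ n → Ones (replicate n true) ≡ true
Ones-all-ones n = ones-accept (replicate n true) (ones-no-zero n) _ 0

Ones-one-zero : ∀ n p → p < n → p ≤ 2 ^ counterExp n → Ones (overwrite (replicate n true) p false) ≡ false
Ones-one-zero n p p<n p≤window =
  subst (λ m → onesFrom x 0 (2 ^ counterExp m) ≡ false) (sym x-length)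
    (ones-reject x p (overwrite-here y p false (subst (p <_) (sym (length-replicate n)) p<n)) _ 0 z≤n p≤window
       (λ q _ q<p → trans (overwrite-elsewhere y p false q (<⇒≢ q<p)) (nth-ones n q (<-trans q<p p<n))))
  where
  y = replicate n true
  x = overwrite y p false
  x-length : length x ≡ n
  x-length = trans (overwrite-length y p false) (length-replicate n)

-- Take n = 2^(2u) with u large, so that the time bound
-- T = c·(2u)^i is at most 2^u.  On the all-ones input y some cell p ≤ T is never
-- read in T steps; setting it to 0 gives x with the same run, yet p lies in the
-- window of length 2^(u+1), so Ones y = true and Ones x = false.
Ones∉PL : ¬ PL Ones
Ones∉PL (M , _ , i , _ , c , n₀ , fast) = answers-differ (begin
    just true            ≡⟨ cong just (sym (Ones-all-ones n)) ⟩
    just (Ones y)        ≡⟨ sym (answer y (length-replicate n)) ⟩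
    result (run M y T)   ≡⟨ cong result (sym (same x (overwrite-elsewhere y p false))) ⟩
    result (run M x T)   ≡⟨ answer x (trans (overwrite-length y p false) (length-replicate n)) ⟩
    just (Ones x)        ≡⟨ cong just (Ones-one-zero n p p<n p≤window) ⟩
    just false           ∎)
  where
  open ≡-Reasoning
  answers-differ : just true ≢ just false
  answers-differ ()
  u₀ = proj₁ (polylog≤√ c i)
  u  = suc (u₀ + n₀)
  K  = u + u
  n  = 2 ^ K
  T  = c * K ^ i
  T≤2^u : T ≤ 2 ^ u
  T≤2^u = proj₂ (polylog≤√ c i) u (≤-trans (m≤m+n u₀ n₀) (n≤1+n _))
  2^u<n : 2 ^ u < n
  2^u<n = ^-monoʳ-< 2 (s≤s (s≤s z≤n)) (m<m+n u {u} z<s)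
  n₀≤n : n₀ ≤ n
  n₀≤n = ≤-trans (≤-trans (m≤n+m n₀ u₀) (n≤1+n _)) (≤-trans (k≤2^k u) (<⇒≤ 2^u<n))
  answer : ∀ z → length z ≡ n → result (run M z T) ≡ just (Ones z)
  answer z len = subst (λ k → HaltsWithin M z (c * k ^ i) (Ones z))
                       (trans (cong ⌊log₂_⌋ len) (⌊log₂[2^n]⌋≡n K))
                       (fast z (subst (n₀ ≤_) (sym len) n₀≤n))
  y = replicate n true
  p = proj₁ (unread-cell M y T)
  p≤T : p ≤ T
  p≤T = proj₁ (proj₂ (unread-cell M y T))
  same : ∀ z → (∀ q → q ≢ p → nth z q ≡ nth y q) → run M z T ≡ run M y T
  same = proj₂ (proj₂ (unread-cell M y T))
  x = overwrite y p false
  p<n : p < n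
  p<n = ≤-<-trans (≤-trans p≤T T≤2^u) 2^u<n
  p≤window : p ≤ 2 ^ counterExp n
  p≤window = subst (λ h → p ≤ 2 ^ h) (sym (counterExp-2^[u+u] u)) (≤-trans (≤-trans p≤T T≤2^u) (^-monoʳ-≤ 2 (n≤1+n u)))

theorem3 : ((P : Problem) → PL P → ST P) × (∃ λ P → ST P × ¬ PL P)
theorem3 = PL⊆ST , (Ones , Ones∈ST , Ones∉PL)
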